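{- Let $G$ be a bidirected graph and $G'$ its doubled graph. Then for signed nodes $u\alpha,v\beta$ of $G$, the pair $\{u\alpha,v\beta\}$ is an ultrabubble in $G$ if and only if $u\neq v$ and both $(u\alpha,v\hat{\beta})$ and $(v\beta,u\hat{\alpha})$ are weak superbubbles in $G'$.
   Context: Bidirected graphs: $G=(V,E)$, finite node set $V$; sign $\alpha\in\{+,-\}$ with opposite $\hat{+}=-$, $\hat{ - }=+$; signed node $v\alpha$; edges are unordered pairs $\{u\alpha,v\beta\}$ of signed nodes ($u=v$ allowed); $w\gamma$ is contained in edge $e$ if $e=\{w\gamma,x\delta\}$. A walk is a sequence $v_1\alpha_1,\dots,v_\ell\alpha_\ell$ with $\{v_i\alpha_i,v_{i+1}\hat{\alpha}_{i+1}\}\in E$ (the edges on the walk); a path is a walk in which no node appears twice (with either sign); a cycloid is a $v\alpha$-$v\beta$-walk with at least one edge ($\alpha,\beta$ arbitrary). Ultrabubble: for distinct $u,v$, the ultrabubble component $B$ of $\{u\alpha,v\beta\}$ consists of $u,v$ and all nodes and edges on $u\alpha$-$v\hat{\beta}$-paths. The pair is separable if for every edge $e\notin E(B)$ and every signed node $w\gamma$ contained in $e$: $w\notin V(B)$ or $w\gamma=u\hat{\alpha}$ or $w\gamma=v\hat{\beta}$; acyclic if $B$ contains no cycloid; it is an ultrabubble if separable, acyclic, and minimal: no signed node $w\gamma$ with $w\in V(B)\setminus\{u,v\}$ makes both $\{u\alpha,w\gamma\}$ and $\{w\hat{\gamma},v\beta\}$ separable and acyclic. Doubled graph: the directed graph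 $G'$ with node set $\{v+,v-: v\in V\}$ and, for each edge $\{u\alpha,v\beta\}\in E$, the two arcs $(u\alpha,v\hat{\beta})$ and $(v\beta,u\hat{\alpha})$. Directed graphs: a $x$-$y$ walk is a node sequence with consecutive pairs being arcs; a path is a walk without repeated nodes; a cycle is a closed walk with at least one arc. Weak superbubble: for an ordered pair $(a,b)$ of distinct nodes of a directed graph $H$, its weak superbubble component $C$ is the subgraph consisting of $a,b$ and all nodes and arcs lying on $a$-$b$ paths. $(a,b)$ is separable if every arc $(x,y)\notin E(C)$ satisfies: $x\in V(C)$ implies $x=b$, and $y\in V(C)$ implies $y=a$; acyclic if $C$ contains no cycle; and $(a,b)$ is a weak superbubble if it is separable, acyclic, and minimal: no node $w\in V(C)\setminus\{a,b\}$ makes both $(a,w)$ and $(w,b)$ separable and acyclic. -}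

module Defs where

open import Data.Nat using (ℕ)
open import Data.Fin using (Fin)
open import Data.Product using (Σ; ∃; ∃-syntax; _×_; _,_; proj₁; proj₂)
open import Data.Sum using (_⊎_)
open import Data.Unit using (⊤)
open import Data.List using (List; []; _∷_; map; concatMap)
open import Data.List.Membership.Propositional using (_∈_)
open import Data.List.Relation.Unary.All using (All)
open import Data.List.Relation.Unary.Unique.Propositional using (Unique)
open import Relation.Nullary using (¬_)
open import Relation.Binary.PropositionalEquality using (_≡_; _≢_)

data Sign : Set where
  ⊕ ⊖ : Sign

hat : Sign → Sign
hat ⊕ = ⊖
hat ⊖ = ⊕

SNode : ℕ → Set
SNode n = Fin n × Sign

flipS : ∀ {n} → SNode n → SNode n
flipS (v , α) = v , hat α

_≈ₑ_ : ∀ {A : Set} → A × A → A × A → Set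
(a , b) ≈ₑ (c , d) = (a ≡ c × b ≡ d) ⊎ (a ≡ d × b ≡ c)

-- Bidirected graphs: finite node set Fin n, edge set given by a list of
-- pairs of signed nodes, each read as an unordered pair {uα, vβ}
-- (loops u = v allowed; repetitions in the list are irrelevant).

record Bidirected : Set where
  field
    n     : ℕ
    edges : List (SNode n × SNode n)

module _ (G : Bidirected) where
  open Bidirected G

  IsEdge : SNode n → SNode n → Set
  IsEdge x y = ∃[ e ] (e ∈ edges × e ≈ₑ (x , y))

  -- A walk is a nonempty sequence x ∷ xs.  steps x xs: consecutive
  -- v_i α_i , v_{i+1} α_{i+1} satisfy {v_i α_i , v_{i+1} α̂_{i+1}} ∈ E.
  bSteps : SNode n → List (SNode n) → Set
  bSteps x []       = ⊤
  bSteps x (y ∷ ys) = IsEdge x (flipS y) × bSteps y ys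

  bEdges : SNode n → List (SNode n) → List (SNode n × SNode n)
  bEdges x []       = []
  bEdges x (y ∷ ys) = (x , flipS y) ∷ bEdges y ys

  bLast : SNode n → List (SNode n) → SNode n
  bLast x []       = x
  bLast x (y ∷ ys) = bLast y ys

  IsBWalk : SNode n → SNode n → List (SNode n) → Set
  IsBWalk a b xs = bSteps a xs × bLast a xs ≡ b

  -- a-b-path: walk in which no node appears twice (with either sign)
  IsBPath : SNode n → SNode n → List (SNode n) → Set
  IsBPath a b xs = IsBWalk a b xs × Unique (map proj₁ (a ∷ xs))

  InVB : SNode n → SNode n → Fin n → Set
  InVB p q w = w ≡ proj₁ p ⊎ w ≡ proj₁ q
             ⊎ ∃[ xs ] (IsBPath p (flipS q) xs × w ∈ map proj₁ (p ∷ xs))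

  InEB : SNode n → SNode n → SNode n × SNode n → Set
  InEB p q e = ∃[ xs ] (IsBPath p (flipS q) xs
                       × ∃[ e' ] (e' ∈ bEdges p xs × e' ≈ₑ e))

  BSeparable : SNode n → SNode n → Set
  BSeparable p q =
    ∀ e → e ∈ edges → ¬ InEB p q e →
    ∀ (wγ : SNode n) → (wγ ≡ proj₁ e ⊎ wγ ≡ proj₂ e) →
    ¬ InVB p q (proj₁ wγ) ⊎ wγ ≡ flipS p ⊎ wγ ≡ flipS q

  IsCycloid : SNode n → List (SNode n) → Set
  IsCycloid x xs = bSteps x xs × xs ≢ [] × proj₁ (bLast x xs) ≡ proj₁ x

  BAcyclic : SNode n → SNode n → Set
  BAcyclic p q = ¬ (∃[ x ] ∃[ xs ] (IsCycloid x xs × All (InEB p q) (bEdges x xs)))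

  BMinimal : SNode n → SNode n → Set
  BMinimal p q = ¬ (∃[ wγ ]
    ( InVB p q (proj₁ wγ) × proj₁ wγ ≢ proj₁ p × proj₁ wγ ≢ proj₁ q
    × BSeparable p wγ × BAcyclic p wγ
    × BSeparable (flipS wγ) q × BAcyclic (flipS wγ) q))

  IsUltrabubble : SNode n → SNode n → Set
  IsUltrabubble p q =
    proj₁ p ≢ proj₁ q × BSeparable p q × BAcyclic p q × BMinimal p q

module _ {D : Set} (A : List (D × D)) where

  dSteps : D → List D → Set
  dSteps x []       = ⊤
  dSteps x (y ∷ ys) = (x , y) ∈ A × dSteps y ys

  dArcs : D → List D → List (D × D)
  dArcs x []       = []
  dArcs x (y ∷ ys) = (x , y) ∷ dArcs y ys

  dLast : D → List D → D
  dLast x []       = x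
  dLast x (y ∷ ys) = dLast y ys

  IsDPath : D → D → List D → Set
  IsDPath a b xs = dSteps a xs × dLast a xs ≡ b × Unique (a ∷ xs)

  InVC : D → D → D → Set
  InVC a b w = w ≡ a ⊎ w ≡ b ⊎ ∃[ xs ] (IsDPath a b xs × w ∈ (a ∷ xs))

  InEC : D → D → D × D → Set
  InEC a b e = ∃[ xs ] (IsDPath a b xs × e ∈ dArcs a xs)

  DSeparable : D → D → Set
  DSeparable a b = ∀ x y → (x , y) ∈ A → ¬ InEC a b (x , y) →
    (InVC a b x → x ≡ b) × (InVC a b y → y ≡ a)

  IsCycle : D → List D → Set
  IsCycle x xs = dSteps x xs × xs ≢ [] × dLast x xs ≡ x

  DAcyclic : D → D → Set
  DAcyclic a b = ¬ (∃[ x ] ∃[ xs ] (IsCycle x xs × All (InEC a b) (dArcs x xs)))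

  DMinimal : D → D → Set
  DMinimal a b = ¬ (∃[ w ]
    ( InVC a b w × w ≢ a × w ≢ b
    × DSeparable a w × DAcyclic a w × DSeparable w b × DAcyclic w b))

  IsWeakSuperbubble : D → D → Set
  IsWeakSuperbubble a b =
    a ≢ b × DSeparable a b × DAcyclic a b × DMinimal a b

doubledArcs : (G : Bidirected) → List (SNode (Bidirected.n G) × SNode (Bidirected.n G))
doubledArcs G = concatMap (λ e → (proj₁ e , flipS (proj₂ e)) ∷ (proj₂ e , flipS (proj₁ e)) ∷ [])
                          (Bidirected.edges G)

{-# OPTIONS --safe #-}

-- In the doubled graph G′ a bidirected uα–vβ̂ path is a directed path that never visits
-- a node with both signs, and reversing a directed walk while flipping all signs gives a
-- walk again, which mirrors a pair (a, b) onto (b̂, â).  Everything hinges on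
-- sign-consistency of the weak superbubble component C of (uα, vβ̂): no x with both x and
-- x̂ in C.  Granted this, C and the ultrabubble component B have the same paths, nodes and
-- edges, and separability, acyclicity and minimality carry over in both directions.
-- If {uα, vβ} is separable and acyclic, a node met with both signs on uα–vβ̂ paths yields a
-- cycloid uα ⇝ uα̂ inside B.  If (uα, vβ̂) is a weak superbubble, a complementary pair in C
-- forces uα̂ or vβ into C, and such a flipped end would split C into two separable acyclic
-- pieces, against minimality.  The second weak superbubble (vβ, uα̂) is the mirror image of
-- the first.

module Submission where

open import Defs
open import Level using (0ℓ)
open import Data.Nat using (ℕ)
open import Data.Fin using (Fin)
import Data.Fin.Properties as Fin
open import Data.Product using (Σ; ∃; ∃-syntax; _×_; _,_; proj₁; proj₂)
open import Data.Product.Properties using (≡-dec)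
open import Data.Sum using (_⊎_; inj₁; inj₂; [_,_]′)
import Data.Sum as Sum
open import Data.Unit using (tt)
open import Data.Empty using (⊥; ⊥-elim)
open import Data.List using (List; []; _∷_; _++_; [_]; map)
open import Data.List.Properties using (++-conicalˡ; ++-conicalʳ)
open import Data.List.Membership.Propositional using (_∈_; _∉_; find; lose)
open import Data.List.Membership.Propositional.Properties
  using (∈-map⁺; ∈-map⁻; ∈-++⁺ˡ; ∈-++⁺ʳ; ∈-++⁻; ∈-concatMap⁺; ∈-concatMap⁻)
open import Data.List.Relation.Unary.Any using (here; there)
open import Data.List.Relation.Unary.All as All using (All; []; _∷_)
import Data.List.Relation.Unary.All.Properties as All
open import Data.List.Relation.Unary.AllPairs using ([]; _∷_)
open import Data.List.Relation.Unary.Unique.Propositional using (Unique)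
import Data.List.Relation.Unary.Unique.Propositional.Properties as Unique
open import Function.Base using (_∘_; id; case_of_)
open import Function.Bundles using (_⇔_; mk⇔)
open import Effect.Monad using (RawMonad)
open import Relation.Binary.Definitions using (DecidableEquality)
open import Relation.Binary.PropositionalEquality
  using (_≡_; _≢_; refl; sym; trans; cong; subst; subst₂)
open import Relation.Nullary using (¬_; Dec; yes; no)
open import Relation.Nullary.Decidable using (decidable-stable)
open import Relation.Nullary.Negation using (¬¬-Monad; contradiction)
open import Relation.Unary using (U)

-- Whether an arc lies in a component is not decided here (that would mean enumerating
-- paths), so case distinctions on it run in the double-negation monad; the goals that
-- leave the monad are negations or decidable equalities.
open RawMonad (¬¬-Monad {0ℓ}) using (pure; _>>=_; _<$>_)

≈ₑ-trans : {X : Set} {e₁ e₂ e₃ : X × X} → e₁ ≈ₑ e₂ → e₂ ≈ₑ e₃ → e₁ ≈ₑ e₃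
≈ₑ-trans {e₁ = _ , _} {_ , _} {_ , _} (inj₁ (refl , refl)) eq = eq
≈ₑ-trans {e₁ = _ , _} {_ , _} {_ , _} (inj₂ (refl , refl)) (inj₁ (refl , refl)) = inj₂ (refl , refl)
≈ₑ-trans {e₁ = _ , _} {_ , _} {_ , _} (inj₂ (refl , refl)) (inj₂ (refl , refl)) = inj₁ (refl , refl)

≈ₑ-endpoint₁ : {X : Set} {e : X × X} {x z : X} → e ≈ₑ (x , z) → x ≡ proj₁ e ⊎ x ≡ proj₂ e
≈ₑ-endpoint₁ (inj₁ (refl , _)) = inj₁ refl
≈ₑ-endpoint₁ (inj₂ (_ , refl)) = inj₂ refl

≈ₑ-endpoint₂ : {X : Set} {e : X × X} {x z : X} → e ≈ₑ (x , z) → z ≡ proj₁ e ⊎ z ≡ proj₂ e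
≈ₑ-endpoint₂ (inj₁ (_ , refl)) = inj₂ refl
≈ₑ-endpoint₂ (inj₂ (refl , _)) = inj₁ refl

by-contradiction : {P : Set} → Dec P → (¬ P → ¬ ¬ ⊥) → P
by-contradiction P? k = decidable-stable P? λ ¬p → k ¬p id

hat-involutive : ∀ α → hat (hat α) ≡ α
hat-involutive ⊕ = refl
hat-involutive ⊖ = refl

_≟ˢ_ : DecidableEquality Sign
⊕ ≟ˢ ⊕ = yes refl
⊕ ≟ˢ ⊖ = no λ ()
⊖ ≟ˢ ⊕ = no λ ()
⊖ ≟ˢ ⊖ = yes refl

module _ {n : ℕ} where

  private variable
    x y : SNode n

  _≟_ : DecidableEquality (SNode n)
  _≟_ = ≡-dec Fin._≟_ _≟ˢ_

  flipS-involutive : (x : SNode n) → flipS (flipS x) ≡ x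
  flipS-involutive (_ , α) = cong (_ ,_) (hat-involutive α)

  flipS-injective : flipS x ≡ flipS y → x ≡ y
  flipS-injective {x} {y} eq =
    trans (sym (flipS-involutive x)) (trans (cong flipS eq) (flipS-involutive y))

  flipS-transpose : flipS x ≡ y → x ≡ flipS y
  flipS-transpose {x} eq = trans (sym (flipS-involutive x)) (cong flipS eq)

  flipS≢ : (x : SNode n) → flipS x ≢ x
  flipS≢ (_ , ⊕) ()
  flipS≢ (_ , ⊖) ()

  same-node : proj₁ x ≡ proj₁ y → x ≡ y ⊎ x ≡ flipS y
  same-node {_ , ⊕} {_ , ⊕} refl = inj₁ refl
  same-node {_ , ⊕} {_ , ⊖} refl = inj₂ refl
  same-node {_ , ⊖} {_ , ⊕} refl = inj₂ refl
  same-node {_ , ⊖} {_ , ⊖} refl = inj₁ refl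

  unique-proj₁ : {l : List (SNode n)} → Unique l → (∀ {x} → x ∈ l → flipS x ∉ l) →
                 Unique (map proj₁ l)
  unique-proj₁ {[]} _ _ = []
  unique-proj₁ {x ∷ l} (x∉ ∷ u) no-pair =
    All.map⁺ (All.tabulate λ {y} m eq → distinct m (same-node eq))
    ∷ unique-proj₁ u (λ m m′ → no-pair (there m) (there m′))
    where
      distinct : ∀ {y} → y ∈ l → x ≡ y ⊎ x ≡ flipS y → ⊥
      distinct m (inj₁ refl) = All.lookup x∉ m refl
      distinct m (inj₂ refl) = no-pair (there m) (here refl)

module Walks {D : Set} (A : List (D × D)) where

  record Walk (P : D × D → Set) (c d : D) : Set where
    constructor walk
    field
      hops  : List D
      steps : dSteps A c hops
      ends  : dLast A c hops ≡ d
      along : All P (dArcs A c hops)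

  open Walk public

  private variable
    P Q : D × D → Set
    V : D → Set
    c d z s t v w : D
    e : D × D

  nodes : Walk P c d → List D
  nodes {c = c} W = c ∷ hops W

  arcs : Walk P c d → List (D × D)
  arcs {c = c} W = dArcs A c (hops W)

  infixr 5 _◅_ _++ʷ_

  []ʷ : Walk P c c
  []ʷ = walk [] tt refl []

  _◅_ : (c , v) ∈ A × P (c , v) → Walk P v d → Walk P c d
  _◅_ {v = v} (a , p) (walk xs st l ps) = walk (v ∷ xs) (a , st) l (p ∷ ps)

  _++ʷ_ : Walk P c d → Walk P d z → Walk P c z
  walk [] _ refl [] ++ʷ W = W
  walk (_ ∷ xs) (a , st) l (p ∷ ps) ++ʷ W = (a , p) ◅ (walk xs st l ps ++ʷ W)

  relabel : (W : Walk P c d) → All Q (arcs W) → Walk Q c d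
  relabel (walk xs st l _) qs = walk xs st l qs

  erase : Walk P c d → Walk U c d
  erase W = relabel W (All.universal _ _)

  empty⇒≡ : (W : Walk P c d) → hops W ≡ [] → c ≡ d
  empty⇒≡ (walk [] _ l _) _ = l

  arcs⊆A : (W : Walk P c d) → e ∈ arcs W → e ∈ A
  arcs⊆A (walk (_ ∷ _) (a , _) _ _) (here refl) = a
  arcs⊆A (walk (_ ∷ xs) (_ , st) l (_ ∷ ps)) (there m) = arcs⊆A (walk xs st l ps) m

  source∈nodes : (W : Walk P c d) → (s , t) ∈ arcs W → s ∈ nodes W
  source∈nodes (walk (_ ∷ _) _ _ _) (here refl) = here refl
  source∈nodes (walk (_ ∷ xs) (_ , st) l (_ ∷ ps)) (there m) =
    there (source∈nodes (walk xs st l ps) m)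

  target∈hops : (W : Walk P c d) → (s , t) ∈ arcs W → t ∈ hops W
  target∈hops (walk (_ ∷ _) _ _ _) (here refl) = here refl
  target∈hops (walk (_ ∷ xs) (_ , st) l (_ ∷ ps)) (there m) =
    there (target∈hops (walk xs st l ps) m)

  end∈nodes : (W : Walk P c d) → d ∈ nodes W
  end∈nodes (walk [] _ refl _) = here refl
  end∈nodes (walk (_ ∷ xs) (_ , st) l (_ ∷ ps)) = there (end∈nodes (walk xs st l ps))

  hop⇒arc-into : (W : Walk P c d) → v ∈ hops W → ∃ λ s → (s , v) ∈ arcs W
  hop⇒arc-into (walk (_ ∷ _) _ _ _) (here refl) = _ , here refl
  hop⇒arc-into (walk (_ ∷ xs) (_ , st) l (_ ∷ ps)) (there m) =
    let s , m′ = hop⇒arc-into (walk xs st l ps) m in s , there m′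

  ∈-arcs-++ʷʳ : (W₁ : Walk P c d) {W₂ : Walk P d z} → e ∈ arcs W₂ → e ∈ arcs (W₁ ++ʷ W₂)
  ∈-arcs-++ʷʳ (walk [] _ refl []) m = m
  ∈-arcs-++ʷʳ (walk (_ ∷ xs) (_ , st) l (_ ∷ ps)) m = there (∈-arcs-++ʷʳ (walk xs st l ps) m)

  hops-++ʷ : (W₁ : Walk P c d) (W₂ : Walk P d z) → hops (W₁ ++ʷ W₂) ≡ hops W₁ ++ hops W₂
  hops-++ʷ (walk [] _ refl []) W₂ = refl
  hops-++ʷ (walk (y ∷ xs) (_ , st) l (_ ∷ ps)) W₂ = cong (y ∷_) (hops-++ʷ (walk xs st l ps) W₂)

  nodes-++ʷ : (W₁ : Walk P c d) (W₂ : Walk P d z) → nodes (W₁ ++ʷ W₂) ≡ nodes W₁ ++ hops W₂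
  nodes-++ʷ W₁ W₂ = cong (_ ∷_) (hops-++ʷ W₁ W₂)

  ∈-arcs-++ʷˡ : (W₁ : Walk P c d) {W₂ : Walk P d z} → e ∈ arcs W₁ → e ∈ arcs (W₁ ++ʷ W₂)
  ∈-arcs-++ʷˡ (walk (_ ∷ xs) (_ , st) l (_ ∷ ps)) (here refl) = here refl
  ∈-arcs-++ʷˡ (walk (_ ∷ xs) (_ , st) l (_ ∷ ps)) (there m) = there (∈-arcs-++ʷˡ (walk xs st l ps) m)

  prefix : (W : Walk P c d) → w ∈ nodes W → Walk P c w
  prefix W (here refl) = []ʷ
  prefix (walk [] _ _ _) (there ())
  prefix (walk (_ ∷ xs) (a , st) l (p ∷ ps)) (there m) = (a , p) ◅ prefix (walk xs st l ps) m

  suffix : (W : Walk P c d) → w ∈ nodes W → Walk P w d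
  suffix W (here refl) = W
  suffix (walk [] _ _ _) (there ())
  suffix (walk (_ ∷ xs) (_ , st) l (_ ∷ ps)) (there m) = suffix (walk xs st l ps) m

  prefix-nodes⊆ : (W : Walk P c d) (m : w ∈ nodes W) → v ∈ nodes (prefix W m) → v ∈ nodes W
  prefix-nodes⊆ W (here refl) (here refl) = here refl
  prefix-nodes⊆ (walk [] _ _ _) (there ())
  prefix-nodes⊆ (walk (_ ∷ xs) (_ , st) l (_ ∷ ps)) (there m) (here refl) = here refl
  prefix-nodes⊆ (walk (_ ∷ xs) (_ , st) l (_ ∷ ps)) (there m) (there k) =
    there (prefix-nodes⊆ (walk xs st l ps) m k)

  suffix-nodes⊆ : (W : Walk P c d) (m : w ∈ nodes W) → v ∈ nodes (suffix W m) → v ∈ nodes W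
  suffix-nodes⊆ W (here refl) k = k
  suffix-nodes⊆ (walk [] _ _ _) (there ())
  suffix-nodes⊆ (walk (_ ∷ xs) (_ , st) l (_ ∷ ps)) (there m) k =
    there (suffix-nodes⊆ (walk xs st l ps) m k)

  before : (W : Walk P c d) → (s , t) ∈ arcs W → Walk P c s
  before W m = prefix W (source∈nodes W m)

  after : (W : Walk P c d) → (s , t) ∈ arcs W → Walk P t d
  after W m = suffix W (there (target∈hops W m))

  propagate-nodes : (∀ {s t} → P (s , t) → V t) → V c → (W : Walk P c d) → All V (nodes W)
  propagate-nodes f vc W =
    vc ∷ All.tabulate λ m → let _ , m′ = hop⇒arc-into W m in f (All.lookup (along W) m′)

  unique⇒sources≢end : (W : Walk P c d) → Unique (nodes W) → (s , t) ∈ arcs W → s ≢ d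
  unique⇒sources≢end (walk (_ ∷ xs) (_ , st) l (_ ∷ ps)) (c∉ ∷ _) (here refl) =
    All.lookup c∉ (end∈nodes (walk xs st l ps))
  unique⇒sources≢end (walk (_ ∷ xs) (_ , st) l (_ ∷ ps)) (_ ∷ u) (there m) =
    unique⇒sources≢end (walk xs st l ps) u m

  distinct⇒nonempty : c ≢ d → (W : Walk P c d) → hops W ≢ []
  distinct⇒nonempty c≢d W = c≢d ∘ empty⇒≡ W

  distinct⇒arc : c ≢ d → (W : Walk P c d) → ∃ λ e → e ∈ arcs W
  distinct⇒arc c≢d (walk [] _ refl _) = contradiction refl c≢d
  distinct⇒arc _ (walk (_ ∷ _) _ _ _) = _ , here refl

  ++ʷ-nonempty : c ≢ d → (W₁ : Walk P c d) (W₂ : Walk P d z) → hops (W₁ ++ʷ W₂) ≢ []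
  ++ʷ-nonempty c≢d W₁ W₂ eq =
    distinct⇒nonempty c≢d W₁ (++-conicalˡ (hops W₁) (hops W₂) (trans (sym (hops-++ʷ W₁ W₂)) eq))

  propagate-end : (∀ {s t} → P (s , t) → V t) → V c → (W : Walk P c d) → V d
  propagate-end f vc W = All.lookup (propagate-nodes f vc W) (end∈nodes W)

  walk⇒path : (W : Walk P c d) → Unique (nodes W) → IsDPath A c d (hops W)
  walk⇒path W u = steps W , ends W , u

module Components {D : Set} (A : List (D × D)) where

  open Walks A

  VC : D → D → D → Set
  VC = InVC A

  EC : D → D → D × D → Set
  EC = InEC A

  Sep : D → D → Set
  Sep = DSeparable A

  Acy : D → D → Set
  Acy = DAcyclic A

  private variable
    P : D × D → Set
    a b c d z s t w : D
    e : D × D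
    xs : List D

  path-walk : IsDPath A a b xs → Walk (EC a b) a b
  path-walk {xs = xs} π@(st , l , _) = walk xs st l (All.tabulate λ m → xs , π , m)

  on-path : IsDPath A a b xs → w ∈ a ∷ xs → VC a b w
  on-path {xs = xs} π m = inj₂ (inj₂ (xs , π , m))

  EC⇒VC : EC a b (s , t) → VC a b s × VC a b t
  EC⇒VC (_ , π , m) =
    on-path π (source∈nodes (path-walk π) m) , on-path π (there (target∈hops (path-walk π) m))

  EC⇒arc : EC a b e → e ∈ A
  EC⇒arc (_ , π , m) = arcs⊆A (path-walk π) m

  ¬EC-into-source : ¬ EC a b (s , a)
  ¬EC-into-source (_ , π@(_ , _ , a∉ ∷ _) , m) = All.lookup a∉ (target∈hops (path-walk π) m) refl

  out-arc-inside : Sep a b → (s , t) ∈ A → VC a b s → s ≢ b → ¬ ¬ EC a b (s , t)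
  out-arc-inside sp arc vs s≢b ¬ec = s≢b (proj₁ (sp _ _ arc ¬ec) vs)

  in-arc-inside : Sep a b → (s , t) ∈ A → VC a b t → t ≢ a → ¬ ¬ EC a b (s , t)
  in-arc-inside sp arc vt t≢a ¬ec = t≢a (proj₂ (sp _ _ arc ¬ec) vt)

  trace-forward : Sep a b → VC a b c → (W : Walk P c d) →
                  (∀ {s t} → (s , t) ∈ arcs W → s ≢ b) → ¬ ¬ All (EC a b) (arcs W)
  trace-forward sp vc (walk [] _ _ []) _ = pure []
  trace-forward sp vc (walk (_ ∷ xs) (arc , st) l (_ ∷ ps)) ≢b = do
    ec ← out-arc-inside sp arc vc (≢b (here refl))
    ecs ← trace-forward sp (proj₂ (EC⇒VC ec)) (walk xs st l ps) (≢b ∘ there)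
    pure (ec ∷ ecs)

  trace-backward : Sep a b → (W : Walk P c d) → VC a b d → a ∉ hops W →
                   ¬ ¬ (VC a b c × All (EC a b) (arcs W))
  trace-backward sp (walk [] _ refl []) vd _ = pure (vd , [])
  trace-backward sp (walk (_ ∷ xs) (arc , st) l (_ ∷ ps)) vd a∉ = do
    vy , ecs ← trace-backward sp (walk xs st l ps) vd (a∉ ∘ there)
    ec ← in-arc-inside sp arc vy (a∉ ∘ here ∘ sym)
    pure (proj₁ (EC⇒VC ec) , ec ∷ ecs)

  PathsInside : (D × D → Set) → D → D → Set
  PathsInside P c d = ∀ {xs} → IsDPath A c d xs → ¬ ¬ All P (dArcs A c xs)

  paths-to-inside : Sep a b → VC a b z → PathsInside (EC a b) a z
  paths-to-inside sp vz π@(_ , _ , a∉ ∷ _) =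
    proj₂ <$> trace-backward sp (path-walk π) vz (λ m → All.lookup a∉ m refl)

  paths-from-inside : Sep a b → VC a b z → PathsInside (EC a b) z b
  paths-from-inside sp vz π =
    trace-forward sp vz (path-walk π) (unique⇒sources≢end (path-walk π) (proj₂ (proj₂ π)))

  walk-from-start : PathsInside P c d → VC c d w → w ≢ d → ¬ ¬ Walk P c w
  walk-from-start _ (inj₁ refl) _ = pure []ʷ
  walk-from-start _ (inj₂ (inj₁ w≡d)) w≢d = contradiction w≡d w≢d
  walk-from-start inside (inj₂ (inj₂ (_ , π , m))) _ = do
    ps ← inside π
    pure (prefix (relabel (path-walk π) ps) m)

  walk-to-end : PathsInside P c d → VC c d w → w ≢ c → ¬ ¬ Walk P w d
  walk-to-end _ (inj₁ w≡c) w≢c = contradiction w≡c w≢c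
  walk-to-end _ (inj₂ (inj₁ refl)) _ = pure []ʷ
  walk-to-end inside (inj₂ (inj₂ (_ , π , m))) _ = do
    ps ← inside π
    pure (suffix (relabel (path-walk π) ps) m)

  inner⇒walk-to-end : VC a b w → w ≢ a → w ≢ b → Walk (EC a b) w b
  inner⇒walk-to-end (inj₁ w≡a) w≢a _ = contradiction w≡a w≢a
  inner⇒walk-to-end (inj₂ (inj₁ w≡b)) _ w≢b = contradiction w≡b w≢b
  inner⇒walk-to-end (inj₂ (inj₂ (_ , π , m))) _ _ = suffix (path-walk π) m

  record Subcomponent (c d a b : D) : Set where
    field
      nodes⊑ : ∀ {w} → VC c d w → ¬ ¬ VC a b w
      arcs⊑  : ∀ {e} → EC c d e → ¬ ¬ EC a b e

  open Subcomponent public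

  subcomponent : VC a b c → VC a b d → PathsInside (EC a b) c d → Subcomponent c d a b
  subcomponent {a} {b} {c} {d} vc vd inside = record { nodes⊑ = nodes⊑′ ; arcs⊑ = arcs⊑′ }
    where
      nodes⊑′ : VC c d w → ¬ ¬ VC a b w
      nodes⊑′ (inj₁ refl) = pure vc
      nodes⊑′ (inj₂ (inj₁ refl)) = pure vd
      nodes⊑′ (inj₂ (inj₂ (_ , π , m))) = do
        ecs ← inside π
        pure (All.lookup (propagate-nodes (proj₂ ∘ EC⇒VC) vc (relabel (path-walk π) ecs)) m)

      arcs⊑′ : EC c d e → ¬ ¬ EC a b e
      arcs⊑′ (_ , π , m) = do
        ecs ← inside π
        pure (All.lookup ecs m)

  prefix-subcomponent : Sep a b → VC a b z → Subcomponent a z a b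
  prefix-subcomponent sp vz = subcomponent (inj₁ refl) vz (paths-to-inside sp vz)

  suffix-subcomponent : Sep a b → VC a b z → Subcomponent z b a b
  suffix-subcomponent sp vz = subcomponent vz (inj₂ (inj₁ refl)) (paths-from-inside sp vz)

  acyclic⇒¬cycle : Acy a b → (W : Walk (EC a b) c c) → hops W ≢ [] → ⊥
  acyclic⇒¬cycle ac W ne = ac (_ , hops W , (steps W , ne , ends W) , along W)

  ¬cycle⇒acyclic : (∀ {c} (W : Walk (EC a b) c c) → hops W ≢ [] → ⊥) → Acy a b
  ¬cycle⇒acyclic no-cycle (_ , xs , (st , ne , l) , ecs) = no-cycle (walk xs st l ecs) ne

  acyclic-⊑ : Acy a b → Subcomponent c d a b → Acy c d
  acyclic-⊑ ac sub (x , xs , cyc , ecs) =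
    All.mapM 0ℓ ¬¬-Monad (arcs⊑ sub) ecs λ ecs′ → ac (x , xs , cyc , ecs′)

  acyclic⇒unique : Acy a b → (W : Walk (EC a b) c d) → Unique (nodes W)
  acyclic⇒unique ac (walk [] _ _ []) = [] ∷ []
  acyclic⇒unique ac (walk (_ ∷ xs) (arc , st) l (ec ∷ ecs)) =
    All.tabulate (λ m c≡v →
      acyclic⇒¬cycle ac ((arc , ec) ◅ prefix W (subst (_∈ nodes W) (sym c≡v) m)) λ ())
    ∷ acyclic⇒unique ac (walk xs st l ecs)
    where W = walk xs st l ecs

  EC⇒walks : EC a b (s , t) → Walk (EC a b) a s × Walk (EC a b) t b
  EC⇒walks (_ , π , m) = before (path-walk π) m , after (path-walk π) m

  EC-through : Acy a b → Walk (EC a b) c s → EC a b (s , t) → Walk (EC a b) t d → EC c d (s , t)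
  EC-through ac W₁ ec W₂ = hops W , walk⇒path W (acyclic⇒unique ac W) , ∈-arcs-++ʷʳ W₁ (here refl)
    where W = W₁ ++ʷ ((EC⇒arc ec , ec) ◅ W₂)

module Doubled (G : Bidirected) where

  open Bidirected G

  N : Set
  N = SNode n

  A : List (N × N)
  A = doubledArcs G

  open Walks A public
  open Components A public
  open import Data.List.Membership.DecPropositional (_≟_ {n}) using (_∈?_)

  private variable
    P Q : N × N → Set
    a b c d s t v w x y : N
    e : N × N
    xs : List N

  arcs-of : N × N → List (N × N)
  arcs-of e = (proj₁ e , flipS (proj₂ e)) ∷ (proj₂ e , flipS (proj₁ e)) ∷ []

  edge⇒arcs : e ∈ edges → (proj₁ e , flipS (proj₂ e)) ∈ A × (proj₂ e , flipS (proj₁ e)) ∈ A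
  edge⇒arcs m =
    ∈-concatMap⁺ arcs-of (lose m (here refl)) , ∈-concatMap⁺ arcs-of (lose m (there (here refl)))

  arc⇒edge : (x , y) ∈ A → IsEdge G x (flipS y)
  arc⇒edge m with find (∈-concatMap⁻ arcs-of {xs = edges} m)
  ... | (e₁ , e₂) , me , here refl = (e₁ , e₂) , me , inj₁ (refl , sym (flipS-involutive e₂))
  ... | (e₁ , e₂) , me , there (here refl) = (e₁ , e₂) , me , inj₂ (sym (flipS-involutive e₁) , refl)

  edge⇒arc : IsEdge G x (flipS y) → (x , y) ∈ A
  edge⇒arc {y = y} ((e₁ , _) , me , inj₁ (refl , refl)) =
    subst (λ z → (e₁ , z) ∈ A) (flipS-involutive y) (proj₁ (edge⇒arcs me))
  edge⇒arc {y = y} ((_ , e₂) , me , inj₂ (refl , refl)) =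
    subst (λ z → (e₂ , z) ∈ A) (flipS-involutive y) (proj₂ (edge⇒arcs me))

  arc-flip : (x , y) ∈ A → (flipS y , flipS x) ∈ A
  arc-flip m with find (∈-concatMap⁻ arcs-of {xs = edges} m)
  ... | (e₁ , e₂) , me , here refl =
    subst (λ z → (z , flipS e₁) ∈ A) (sym (flipS-involutive e₂)) (proj₂ (edge⇒arcs me))
  ... | (e₁ , e₂) , me , there (here refl) =
    subst (λ z → (z , flipS e₂) ∈ A) (sym (flipS-involutive e₁)) (proj₁ (edge⇒arcs me))

  reverseʷ : (∀ {s t} → P (s , t) → Q (flipS t , flipS s)) → Walk P c d → Walk Q (flipS d) (flipS c)
  reverseʷ f (walk [] _ refl []) = []ʷ
  reverseʷ f (walk (_ ∷ xs) (arc , st) l (p ∷ ps)) =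
    reverseʷ f (walk xs st l ps) ++ʷ ((arc-flip arc , f p) ◅ []ʷ)

  module Reversal {P Q : N × N → Set} (f : ∀ {s t} → P (s , t) → Q (flipS t , flipS s)) where

    private
      rev : Walk P c d → Walk Q (flipS d) (flipS c)
      rev = reverseʷ f

    ∈-nodes-reverse⁺ : (W : Walk P c d) → v ∈ nodes W → flipS v ∈ nodes (rev W)
    ∈-nodes-reverse⁺ (walk [] _ refl []) (here refl) = here refl
    ∈-nodes-reverse⁺ {c = c} {v = v} (walk (_ ∷ xs) (arc , st) l (p ∷ ps)) m =
      subst (flipS v ∈_) (sym (nodes-++ʷ R _)) (go m)
      where
        R = rev (walk xs st l ps)
        go : v ∈ c ∷ nodes (walk xs st l ps) → flipS v ∈ nodes R ++ [ flipS c ]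
        go (here refl) = ∈-++⁺ʳ (nodes R) (here refl)
        go (there k) = ∈-++⁺ˡ (∈-nodes-reverse⁺ (walk xs st l ps) k)

    ∈-nodes-reverse⁻ : (W : Walk P c d) → v ∈ nodes (rev W) → flipS v ∈ nodes W
    ∈-nodes-reverse⁻ {c = c} (walk [] _ refl []) (here refl) = here (flipS-involutive c)
    ∈-nodes-reverse⁻ {c = c} {v = v} (walk (_ ∷ xs) (arc , st) l (p ∷ ps)) m =
      [ there ∘ ∈-nodes-reverse⁻ (walk xs st l ps) , (λ { (here refl) → here (flipS-involutive c) }) ]′
        (∈-++⁻ (nodes R) (subst (v ∈_) (nodes-++ʷ R _) m))
      where R = rev (walk xs st l ps)

    reverse-unique : (W : Walk P c d) → Unique (nodes W) → Unique (nodes (rev W))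
    reverse-unique (walk [] _ refl []) _ = [] ∷ []
    reverse-unique {c = c} (walk (_ ∷ xs) (arc , st) l (p ∷ ps)) (c∉ ∷ u) =
      subst Unique (sym (nodes-++ʷ R _))
        (Unique.++⁺ (reverse-unique (walk xs st l ps) u) ([] ∷ []) disjoint)
      where
        R = rev (walk xs st l ps)
        disjoint : ∀ {v} → ¬ (v ∈ nodes R × v ∈ [ flipS c ])
        disjoint (k , here refl) =
          All.lookup c∉ (∈-nodes-reverse⁻ (walk xs st l ps) k) (sym (flipS-involutive c))

    ∈-arcs-reverse⁺ : (W : Walk P c d) → (s , t) ∈ arcs W → (flipS t , flipS s) ∈ arcs (rev W)
    ∈-arcs-reverse⁺ (walk (_ ∷ xs) (arc , st) l (p ∷ ps)) (here refl) =
      ∈-arcs-++ʷʳ (rev (walk xs st l ps)) (here refl)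
    ∈-arcs-reverse⁺ (walk (_ ∷ xs) (arc , st) l (p ∷ ps)) (there m) =
      ∈-arcs-++ʷˡ (rev (walk xs st l ps)) (∈-arcs-reverse⁺ (walk xs st l ps) m)

    reverse-nonempty : (W : Walk P c d) → hops W ≢ [] → hops (rev W) ≢ []
    reverse-nonempty (walk [] _ _ _) ne = contradiction refl ne
    reverse-nonempty {c = c} (walk (_ ∷ xs) (arc , st) l (p ∷ ps)) _ eq
      with () ← ++-conicalʳ _ [ flipS c ] (trans (sym (hops-++ʷ (rev (walk xs st l ps)) _)) eq)

  open Reversal public

  private
    module Reversalᵁ = Reversal {P = U} {Q = U} _

    reverseᵁ : Walk U c d → Walk U (flipS d) (flipS c)
    reverseᵁ = reverseʷ _

    reversed-path : (π : IsDPath A a b xs) →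
                    IsDPath A (flipS b) (flipS a) (hops (reverseᵁ (erase (path-walk π))))
    reversed-path π =
      walk⇒path (reverseᵁ (erase (path-walk π)))
                (Reversalᵁ.reverse-unique (erase (path-walk π)) (proj₂ (proj₂ π)))

  VC-flip : VC a b w → VC (flipS b) (flipS a) (flipS w)
  VC-flip (inj₁ refl) = inj₂ (inj₁ refl)
  VC-flip (inj₂ (inj₁ refl)) = inj₁ refl
  VC-flip (inj₂ (inj₂ (_ , π , m))) =
    on-path (reversed-path π) (Reversalᵁ.∈-nodes-reverse⁺ (erase (path-walk π)) m)

  EC-flip : EC a b (s , t) → EC (flipS b) (flipS a) (flipS t , flipS s)
  EC-flip (_ , π , m) = _ , reversed-path π , Reversalᵁ.∈-arcs-reverse⁺ (erase (path-walk π)) m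

  VC-unflip : VC (flipS b) (flipS a) w → VC a b (flipS w)
  VC-unflip {b} {a} {w} v =
    subst₂ (λ a′ b′ → VC a′ b′ (flipS w)) (flipS-involutive a) (flipS-involutive b) (VC-flip v)

  EC-unflip : EC (flipS b) (flipS a) (s , t) → EC a b (flipS t , flipS s)
  EC-unflip {b} {a} {s} {t} ec =
    subst₂ (λ a′ b′ → EC a′ b′ (flipS t , flipS s)) (flipS-involutive a) (flipS-involutive b)
           (EC-flip ec)

  separable-flip : Sep a b → Sep (flipS b) (flipS a)
  separable-flip {a} {b} sp x y arc ¬ec =
    (λ vx → flipS-transpose (proj₂ sep (VC-unflip vx))) ,
    (λ vy → flipS-transpose (proj₁ sep (VC-unflip vy)))
    where
      sep = sp (flipS y) (flipS x) (arc-flip arc) λ ec →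
        ¬ec (subst₂ (λ s t → EC (flipS b) (flipS a) (s , t)) (flipS-involutive x) (flipS-involutive y)
                    (EC-flip ec))

  acyclic-flip : Acy a b → Acy (flipS b) (flipS a)
  acyclic-flip ac = ¬cycle⇒acyclic λ W ne →
    acyclic⇒¬cycle ac (reverseʷ EC-unflip W) (reverse-nonempty EC-unflip W ne)

  minimal-flip : DMinimal A a b → DMinimal A (flipS b) (flipS a)
  minimal-flip {a} {b} mn (w , vw , w≢b̂ , w≢â , sep₁ , acy₁ , sep₂ , acy₂) =
    mn (flipS w , VC-unflip vw , w≢â ∘ flipS-transpose , w≢b̂ ∘ flipS-transpose ,
        subst (λ a′ → Sep a′ (flipS w)) (flipS-involutive a) (separable-flip sep₂) ,
        subst (λ a′ → Acy a′ (flipS w)) (flipS-involutive a) (acyclic-flip acy₂) ,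
        subst (Sep (flipS w)) (flipS-involutive b) (separable-flip sep₁) ,
        subst (Acy (flipS w)) (flipS-involutive b) (acyclic-flip acy₁))

  superbubble-flip : IsWeakSuperbubble A a b → IsWeakSuperbubble A (flipS b) (flipS a)
  superbubble-flip (a≢b , sp , ac , mn) =
    a≢b ∘ sym ∘ flipS-injective , separable-flip sp , acyclic-flip ac , minimal-flip mn

  SignConsistent : N → N → Set
  SignConsistent a b = ∀ x → VC a b x → ¬ VC a b (flipS x)

  consistent-⊑ : SignConsistent a b → Subcomponent c d a b → SignConsistent c d
  consistent-⊑ sc sub x v₁ v₂ = nodes⊑ sub v₁ λ u₁ → nodes⊑ sub v₂ λ u₂ → sc x u₁ u₂

  -- If â lies in C(a,b) and â ≢ b, then â is a witness against the minimality of (a,b).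
  module FlippedSource {a b : N} (a≢b : a ≢ b) (â≢b : flipS a ≢ b) (sp : Sep a b) (ac : Acy a b)
                       (vâ : VC a b (flipS a)) where

    â : N
    â = flipS a

    VC-mirror : VC a â w → VC a â (flipS w)
    VC-mirror {w} v = subst (λ a′ → VC a′ â (flipS w)) (flipS-involutive a) (VC-flip v)

    EC-mirror : EC a â (s , t) → EC a â (flipS t , flipS s)
    EC-mirror {s} {t} ec = subst (λ a′ → EC a′ â (flipS t , flipS s)) (flipS-involutive a) (EC-flip ec)

    walks-to-â : VC a â w → w ≢ a → ¬ ¬ Walk (EC a b) w â
    walks-to-â = walk-to-end (paths-to-inside sp vâ)

    walks-from-â : VC â b w → ¬ ¬ Walk (EC a b) â w
    walks-from-â {w} vw with w ≟ b
    ... | yes refl = pure (inner⇒walk-to-end vâ (flipS≢ a) â≢b)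
    ... | no w≢b = walk-from-start (paths-from-inside sp vâ) vw w≢b

    a∉C[â,b] : ¬ VC â b a
    a∉C[â,b] (inj₁ a≡â) = flipS≢ a (sym a≡â)
    a∉C[â,b] (inj₂ (inj₁ a≡b)) = a≢b a≡b
    a∉C[â,b] (inj₂ (inj₂ (_ , π , here a≡â))) = flipS≢ a (sym a≡â)
    a∉C[â,b] (inj₂ (inj₂ (_ , π , there m))) = paths-from-inside sp vâ π λ ecs →
      ¬EC-into-source (All.lookup ecs (proj₂ (hop⇒arc-into (path-walk π) m)))

    sep-aâ : Sep a â
    sep-aâ x y arc ¬ec = x-end , y-start
      where
        x-end : VC a â x → x ≡ â
        x-end vx = by-contradiction (x ≟ â) λ x≢â → do
          let x̂≢a = x≢â ∘ flipS-transpose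
          vx̂ ← nodes⊑ (prefix-subcomponent sp vâ) (VC-mirror vx)
          ec ← in-arc-inside sp (arc-flip arc) vx̂ x̂≢a
          x̂⇝â ← walks-to-â (VC-mirror vx) x̂≢a
          pure (¬ec (subst₂ (λ s t → EC a â (s , t)) (flipS-involutive x) (flipS-involutive y)
                      (EC-mirror (EC-through ac (proj₁ (EC⇒walks ec)) ec x̂⇝â))))

        y-start : VC a â y → y ≡ a
        y-start vy = by-contradiction (y ≟ a) λ y≢a → do
          vy′ ← nodes⊑ (prefix-subcomponent sp vâ) vy
          ec ← in-arc-inside sp arc vy′ y≢a
          y⇝â ← walks-to-â vy y≢a
          pure (¬ec (EC-through ac (proj₁ (EC⇒walks ec)) ec y⇝â))

    acy-aâ : Acy a â
    acy-aâ = acyclic-⊑ ac (prefix-subcomponent sp vâ)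

    C[a,â]∩C[â,b] : VC a â y → VC â b y → y ≡ â
    C[a,â]∩C[â,b] {y} vy₁ vy₂ = by-contradiction (y ≟ â) λ y≢â → do
      let y≢a = λ y≡a → a∉C[â,b] (subst (VC â b) y≡a vy₂)
      y⇝â ← walks-to-â vy₁ y≢a
      â⇝y ← walks-from-â vy₂
      pure (acyclic⇒¬cycle ac (y⇝â ++ʷ â⇝y) (++ʷ-nonempty y≢â y⇝â â⇝y))

    sep-âb : Sep â b
    sep-âb x y arc ¬ec = x-end , y-start
      where
        x-end : VC â b x → x ≡ b
        x-end vx = by-contradiction (x ≟ b) λ x≢b → do
          vx′ ← nodes⊑ (suffix-subcomponent sp vâ) vx
          ec ← out-arc-inside sp arc vx′ x≢b
          â⇝x ← walks-from-â vx
          pure (¬ec (EC-through ac â⇝x ec (proj₂ (EC⇒walks ec))))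

        y-start : VC â b y → y ≡ â
        y-start vy = by-contradiction (y ≟ â) λ y≢â → do
          vy′ ← nodes⊑ (suffix-subcomponent sp vâ) vy
          ec ← in-arc-inside sp arc vy′ (λ y≡a → a∉C[â,b] (subst (VC â b) y≡a vy))
          let a⇝x , y⇝b = EC⇒walks ec
          case â ∈? nodes a⇝x of λ where
            (yes m) → pure (¬ec (EC-through ac (suffix a⇝x m) ec y⇝b))
            (no â∉) → do
              -- a ⇝ x avoids â, so it stays in C(a,â), and then so does y.
              ecs ← trace-forward sep-aâ (inj₁ refl) a⇝x
                      (λ k s≡â → â∉ (subst (_∈ nodes a⇝x) s≡â (source∈nodes a⇝x k)))
              let vx = propagate-end (proj₂ ∘ EC⇒VC) (inj₁ refl) (relabel a⇝x ecs)
              ec′ ← out-arc-inside sep-aâ arc vx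
                      (λ x≡â → â∉ (subst (_∈ nodes a⇝x) x≡â (end∈nodes a⇝x)))
              pure (y≢â (C[a,â]∩C[â,b] (proj₂ (EC⇒VC ec′)) vy))

    acy-âb : Acy â b
    acy-âb = acyclic-⊑ ac (suffix-subcomponent sp vâ)

  flipped-source∉ : IsWeakSuperbubble A a b → flipS a ≢ b → ¬ VC a b (flipS a)
  flipped-source∉ {a} (a≢b , sp , ac , mn) â≢b vâ =
    mn (flipS a , vâ , flipS≢ a , â≢b , sep-aâ , acy-aâ , sep-âb , acy-âb)
    where open FlippedSource a≢b â≢b sp ac vâ

  -- Reversing the subpath x ⇝ b gives a walk b̂ ⇝ x̂ ending in C: either it passes through a,
  -- which puts â on the path, or it runs inside C all the way back to b̂.
  complementary⇒flipped-end : Sep a b → VC a b x → VC a b (flipS x) →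
                              ¬ ¬ (VC a b (flipS a) ⊎ VC a b (flipS b))
  complementary⇒flipped-end sp (inj₁ refl) vx̂ = pure (inj₁ vx̂)
  complementary⇒flipped-end sp (inj₂ (inj₁ refl)) vx̂ = pure (inj₂ vx̂)
  complementary⇒flipped-end {a} {b} sp (inj₂ (inj₂ (_ , π , m))) vx̂ = go (a ∈? hops R)
    where
      x⇝b = erase (suffix (path-walk π) m)
      R = reverseᵁ x⇝b

      go : Dec (a ∈ hops R) → ¬ ¬ (VC a b (flipS a) ⊎ VC a b (flipS b))
      go (yes k) = pure (inj₁ (on-path π
        (suffix-nodes⊆ (path-walk π) m (Reversalᵁ.∈-nodes-reverse⁻ x⇝b (there k)))))
      go (no a∉) = do
        vb̂ , _ ← trace-backward sp R vx̂ a∉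
        pure (inj₂ vb̂)

  superbubble⇒consistent : IsWeakSuperbubble A a b → flipS a ≢ b → SignConsistent a b
  superbubble⇒consistent {a} {b} wsb@(_ , sp , _) â≢b x vx vx̂ =
    complementary⇒flipped-end sp vx vx̂ λ
      { (inj₁ vâ) → flipped-source∉ wsb â≢b vâ
      ; (inj₂ vb̂) → flipped-source∉ (superbubble-flip wsb)
                      (â≢b ∘ sym ∘ flipS-transpose ∘ flipS-injective) (VC-flip vb̂) }

module Correspondence (G : Bidirected) where

  open Bidirected G
  open Doubled G

  private variable
    P : N × N → Set
    a c d s t w x y : N
    e e′ : N × N
    xs : List N

  bedge : N × N → N × N
  bedge (x , y) = x , flipS y

  bSteps⇒dSteps : ∀ x xs → bSteps G x xs → dSteps A x xs
  bSteps⇒dSteps x [] _ = tt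
  bSteps⇒dSteps x (y ∷ ys) (e , st) = edge⇒arc e , bSteps⇒dSteps y ys st

  dSteps⇒bSteps : ∀ x xs → dSteps A x xs → bSteps G x xs
  dSteps⇒bSteps x [] _ = tt
  dSteps⇒bSteps x (y ∷ ys) (arc , st) = arc⇒edge arc , dSteps⇒bSteps y ys st

  bLast≡dLast : ∀ x xs → bLast G x xs ≡ dLast A x xs
  bLast≡dLast x [] = refl
  bLast≡dLast x (y ∷ ys) = bLast≡dLast y ys

  bEdges≡ : ∀ x xs → bEdges G x xs ≡ map bedge (dArcs A x xs)
  bEdges≡ x [] = refl
  bEdges≡ x (y ∷ ys) = cong ((x , flipS y) ∷_) (bEdges≡ y ys)

  bpath⇒dpath : IsBPath G a c xs → IsDPath A a c xs
  bpath⇒dpath {a} {xs = xs} ((st , l) , u) =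
    bSteps⇒dSteps a xs st , trans (sym (bLast≡dLast a xs)) l , Unique.map⁻ u

  dpath⇒bpath : IsDPath A a c xs → Unique (map proj₁ (a ∷ xs)) → IsBPath G a c xs
  dpath⇒bpath {a} {xs = xs} (st , l , _) u =
    (dSteps⇒bSteps a xs st , trans (bLast≡dLast a xs) l) , u

  InEB-resp : ∀ {p q} → InEB G p q e → e ≈ₑ e′ → InEB G p q e′
  InEB-resp (xs , bp , e″ , m , eq) eq′ = xs , bp , e″ , m , ≈ₑ-trans eq eq′

  endpoint⇒arc : e ∈ edges → w ≡ proj₁ e ⊎ w ≡ proj₂ e →
                 ∃ λ y → (w , y) ∈ A × bedge (w , y) ≈ₑ e
  endpoint⇒arc {_ , e₂} me (inj₁ refl) =
    flipS e₂ , proj₁ (edge⇒arcs me) , inj₁ (refl , flipS-involutive e₂)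
  endpoint⇒arc {e₁ , _} me (inj₂ refl) =
    flipS e₁ , proj₂ (edge⇒arcs me) , inj₂ (refl , flipS-involutive e₁)

  -- p = uα and q = vβ; the bidirected pair {p, q} corresponds to the pair (p, b) of G′.
  module Bubble (p q : N) where

    b : N
    b = flipS q

    VB : Fin n → Set
    VB = InVB G p q

    EB : N × N → Set
    EB e = InEB G p q (bedge e)

    on-bpath : IsBPath G p b xs → w ∈ p ∷ xs → VB (proj₁ w)
    on-bpath {xs = xs} bp m = inj₂ (inj₂ (xs , bp , ∈-map⁺ proj₁ m))

    bpath-walk : IsBPath G p b xs → Walk EB p b
    bpath-walk {xs} bp = walk xs st l (All.tabulate λ m →
      xs , bp , _ , subst (_ ∈_) (sym (bEdges≡ p xs)) (∈-map⁺ bedge m) , inj₁ (refl , refl))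
      where
        st = proj₁ (bpath⇒dpath bp)
        l = proj₁ (proj₂ (bpath⇒dpath bp))

    EB⇒bpath-arc : InEB G p q e →
             ∃[ xs ] Σ (IsBPath G p b xs) λ _ → ∃[ st ] (st ∈ dArcs A p xs × bedge st ≈ₑ e)
    EB⇒bpath-arc (xs , bp , e′ , m , eq) with ∈-map⁻ bedge (subst (e′ ∈_) (bEdges≡ p xs) m)
    ... | st , m′ , refl = xs , bp , st , m′ , eq

    EB⇒EC± : EB (x , y) → EC p b (x , y) ⊎ EC p b (flipS y , flipS x)
    EB⇒EC± eb with EB⇒bpath-arc eb
    ... | xs , bp , st , m , inj₁ (refl , t̂≡ŷ) =
      inj₁ (subst (λ t → EC p b (_ , t)) (flipS-injective t̂≡ŷ) (xs , bpath⇒dpath bp , m))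
    ... | xs , bp , st , m , inj₂ (refl , t̂≡x) =
      inj₂ (subst (λ t → EC p b (_ , t)) (flipS-transpose t̂≡x) (xs , bpath⇒dpath bp , m))

    EB⇒VB : EB (s , t) → VB (proj₁ s) × VB (proj₁ t)
    EB⇒VB eb with EB⇒bpath-arc eb
    ... | xs , bp , st , m , eq = ends-VB eq
      where
        W = bpath-walk bp
        vs = on-bpath bp (source∈nodes W m)
        vt = on-bpath bp (there (target∈hops W m))
        ends-VB : bedge st ≈ₑ e → VB (proj₁ (proj₁ e)) × VB (proj₁ (proj₂ e))
        ends-VB (inj₁ (refl , refl)) = vs , vt
        ends-VB (inj₂ (refl , refl)) = vt , vs

    EB-flip : EB (s , t) → EB (flipS t , flipS s)
    EB-flip {s} eb = InEB-resp eb (inj₂ (sym (flipS-involutive s) , refl))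

    VB⇒VC : VB (proj₁ w) → ∃ λ x → VC p b x × proj₁ x ≡ proj₁ w
    VB⇒VC (inj₁ eq) = p , inj₁ refl , sym eq
    VB⇒VC (inj₂ (inj₁ eq)) = b , inj₂ (inj₁ refl) , sym eq
    VB⇒VC (inj₂ (inj₂ (xs , bp , m))) with ∈-map⁻ proj₁ m
    ... | x , mx , eq = x , on-path (bpath⇒dpath bp) mx , sym eq

    module Consistent (sc : SignConsistent p b) where

      dpath⇒bpath′ : IsDPath A p b xs → IsBPath G p b xs
      dpath⇒bpath′ π =
        dpath⇒bpath π (unique-proj₁ (proj₂ (proj₂ π)) λ m m′ → sc _ (on-path π m) (on-path π m′))

      VC⇒VB : VC p b x → VB (proj₁ x)
      VC⇒VB (inj₁ refl) = inj₁ refl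
      VC⇒VB (inj₂ (inj₁ refl)) = inj₂ (inj₁ refl)
      VC⇒VB (inj₂ (inj₂ (_ , π , m))) = on-bpath (dpath⇒bpath′ π) m

      EC⇒EB : EC p b (s , t) → EB (s , t)
      EC⇒EB (_ , π , m) = All.lookup (along (bpath-walk (dpath⇒bpath′ π))) m

    module FromBubble (bsep : BSeparable G p q) (bacy : BAcyclic G p q) where

      no-cycloid : (W : Walk EB c d) → hops W ≢ [] → proj₁ d ≡ proj₁ c → ⊥
      no-cycloid {c} W ne same =
        bacy (c , hops W ,
              (dSteps⇒bSteps c (hops W) (steps W) , ne ,
               trans (cong proj₁ (trans (bLast≡dLast c (hops W)) (ends W))) same) ,
              subst (All (InEB G p q)) (sym (bEdges≡ c (hops W))) (All.map⁺ (along W)))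

      no-flip-walk : Walk EB c (flipS c) → ⊥
      no-flip-walk {c} W = no-cycloid W (distinct⇒nonempty (flipS≢ c ∘ sym) W) refl

      separable-at-arc : (x , y) ∈ A → ¬ EB (x , y) →
                 (¬ VB (proj₁ x) ⊎ x ≡ flipS p ⊎ x ≡ b) × (¬ VB (proj₁ y) ⊎ y ≡ p ⊎ y ≡ q)
      separable-at-arc arc ¬eb with arc⇒edge arc
      ... | e , me , eq =
        bsep e me ¬ie _ (≈ₑ-endpoint₁ eq) ,
        Sum.map₂ (Sum.map flipS-injective flipS-injective) (bsep e me ¬ie _ (≈ₑ-endpoint₂ eq))
        where ¬ie = λ ie → ¬eb (InEB-resp ie eq)

      bidirected-trace : (W : Walk P p d) → (∀ {s t} → (s , t) ∈ arcs W → s ≢ b) → ¬ ¬ All EB (arcs W)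
      bidirected-trace = go []ʷ
        where
          step : Walk EB p c → (c , y) ∈ A → c ≢ b → ¬ ¬ EB (c , y)
          step pre arc c≢b ¬eb with proj₁ (separable-at-arc arc ¬eb)
          ... | inj₁ ¬vb = ¬vb (propagate-end {V = VB ∘ proj₁} (proj₂ ∘ EB⇒VB) (inj₁ refl) pre)
          ... | inj₂ (inj₁ c≡p̂) = no-flip-walk (subst (Walk EB p) c≡p̂ pre)
          ... | inj₂ (inj₂ c≡b) = c≢b c≡b

          go : Walk EB p c → (W : Walk P c d) → (∀ {s t} → (s , t) ∈ arcs W → s ≢ b) →
               ¬ ¬ All EB (arcs W)
          go _ (walk [] _ _ []) _ = pure []
          go pre (walk (_ ∷ xs) (arc , st) l (_ ∷ ps)) ≢b = do
            eb ← step pre arc (≢b (here refl))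
            ebs ← go (pre ++ʷ ((arc , eb) ◅ []ʷ)) (walk xs st l ps) (≢b ∘ there)
            pure (eb ∷ ebs)

      bpaths-inside : PathsInside EB p b
      bpaths-inside π =
        bidirected-trace (path-walk π) (unique⇒sources≢end (path-walk π) (proj₂ (proj₂ π)))

      complementary-walks : Walk EB p x → Walk EB p (flipS x) → ⊥
      complementary-walks {x} W₁ W₂ = no-flip-walk
        (W₁ ++ʷ subst (λ z → Walk EB z (flipS p)) (flipS-involutive x) (reverseʷ EB-flip W₂))

      reachable : IsDPath A p b xs → VC p b w → ¬ ¬ Walk EB p w
      reachable _ (inj₁ refl) = pure []ʷ
      reachable π (inj₂ (inj₁ refl)) = relabel (path-walk π) <$> bpaths-inside π
      reachable _ (inj₂ (inj₂ (_ , π , m))) =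
        (λ ebs → prefix (relabel (path-walk π) ebs) m) <$> bpaths-inside π

      consistent : proj₁ p ≢ proj₁ q → SignConsistent p b
      consistent _ x vx@(inj₂ (inj₂ (_ , π , _))) vx̂ =
        reachable π vx λ W₁ → reachable π vx̂ λ W₂ → complementary-walks W₁ W₂
      consistent _ x vx vx̂@(inj₂ (inj₂ (_ , π , _))) =
        reachable π vx λ W₁ → reachable π vx̂ λ W₂ → complementary-walks W₁ W₂
      consistent _ x (inj₁ refl) (inj₁ x̂≡x) = flipS≢ x x̂≡x
      consistent p≁q x (inj₁ refl) (inj₂ (inj₁ x̂≡b)) = p≁q (cong proj₁ x̂≡b)
      consistent p≁q x (inj₂ (inj₁ refl)) (inj₁ x̂≡p) = p≁q (sym (cong proj₁ x̂≡p))
      consistent _ x (inj₂ (inj₁ refl)) (inj₂ (inj₁ x̂≡x)) = flipS≢ x x̂≡x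

      module _ (sc : SignConsistent p b) where

        open Consistent sc

        outside-arc : ¬ EC p b (x , y) → VC p b x ⊎ VC p b y → ¬ EB (x , y)
        outside-arc {x} {y} ¬ec vxy eb with EB⇒EC± eb
        ... | inj₁ ec = ¬ec ec
        ... | inj₂ ec =
          [ (λ vx → sc x vx (proj₂ (EC⇒VC ec))) , (λ vy → sc y vy (proj₁ (EC⇒VC ec))) ]′ vxy

        directed-separable : Sep p b
        directed-separable x y arc ¬ec = x-end , y-start
          where
            x-end : VC p b x → x ≡ b
            x-end vx with proj₁ (separable-at-arc arc (outside-arc ¬ec (inj₁ vx)))
            ... | inj₁ ¬vb = ⊥-elim (¬vb (VC⇒VB vx))
            ... | inj₂ (inj₁ x≡p̂) = ⊥-elim (sc p (inj₁ refl) (subst (VC p b) x≡p̂ vx))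
            ... | inj₂ (inj₂ x≡b) = x≡b

            y-start : VC p b y → y ≡ p
            y-start vy with proj₂ (separable-at-arc arc (outside-arc ¬ec (inj₂ vy)))
            ... | inj₁ ¬vb = ⊥-elim (¬vb (VC⇒VB vy))
            ... | inj₂ (inj₁ y≡p) = y≡p
            ... | inj₂ (inj₂ y≡q) =
              ⊥-elim (sc y vy (subst (λ z → VC p b (flipS z)) (sym y≡q) (inj₂ (inj₁ refl))))

        directed-acyclic : Acy p b
        directed-acyclic = ¬cycle⇒acyclic λ W ne →
          no-cycloid (relabel W (All.map EC⇒EB (along W))) ne refl

    module FromSuperbubble (sc : SignConsistent p b) (sp : Sep p b) (ac : Acy p b) where

      open Consistent sc

      outside-node : (x , y) ∈ A → ¬ EB (x , y) → x ≢ flipS p → x ≢ b → ¬ VB (proj₁ x)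
      outside-node {x} {y} arc ¬eb x≢p̂ x≢b vb with VB⇒VC {w = x} vb
      ... | z , vz , same with same-node {x = z} {y = x} same
      ...   | inj₁ refl = x≢b (proj₁ (sp x y arc (¬eb ∘ EC⇒EB)) vz)
      ...   | inj₂ refl = x≢p̂ (flipS-transpose (proj₂ (sp (flipS y) (flipS x) (arc-flip arc) ¬ec) vz))
        where
          ¬ec : ¬ EC p b (flipS y , flipS x)
          ¬ec ec = ¬eb (subst₂ (λ s t → EB (s , t)) (flipS-involutive x) (flipS-involutive y)
                               (EB-flip (EC⇒EB ec)))

      bubble-separable : BSeparable G p q
      bubble-separable e me ¬ie w side with w ≟ flipS p | w ≟ b
      ... | yes w≡p̂ | _ = inj₂ (inj₁ w≡p̂)
      ... | no _ | yes w≡b = inj₂ (inj₂ w≡b)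
      ... | no w≢p̂ | no w≢b with endpoint⇒arc me side
      ...   | y , arc , eq = inj₁ (outside-node arc (λ eb → ¬ie (InEB-resp eb eq)) w≢p̂ w≢b)

      EC± : N × N → Set
      EC± (x , y) = EC p b (x , y) ⊎ EC p b (flipS y , flipS x)

      EC±-mirror : EC± (x , y) → EC± (flipS y , flipS x)
      EC±-mirror {x} {y} (inj₁ ec) =
        inj₂ (subst₂ (λ s t → EC p b (s , t)) (sym (flipS-involutive x)) (sym (flipS-involutive y)) ec)
      EC±-mirror (inj₂ ec) = inj₁ ec

      EC±-from-C : VC p b c → (W : Walk EC± c d) → All (EC p b) (arcs W)
      EC±-from-C vc (walk [] _ _ []) = []
      EC±-from-C vc (walk (_ ∷ xs) (_ , st) l (inj₁ ec ∷ ps)) =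
        ec ∷ EC±-from-C (proj₂ (EC⇒VC ec)) (walk xs st l ps)
      EC±-from-C vc (walk (_ ∷ xs) (_ , st) l (inj₂ ec ∷ ps)) = ⊥-elim (sc _ vc (proj₂ (EC⇒VC ec)))

      EC±-into-C : VC p b d → (W : Walk EC± c d) → VC p b c × All (EC p b) (arcs W)
      EC±-into-C vd (walk [] _ refl []) = vd , []
      EC±-into-C vd (walk (_ ∷ xs) (_ , st) l (p′ ∷ ps)) with EC±-into-C vd (walk xs st l ps) | p′
      ... | vy , ecs | inj₁ ec = proj₁ (EC⇒VC ec) , ec ∷ ecs
      ... | vy , ecs | inj₂ ec = ⊥-elim (sc _ vy (proj₁ (EC⇒VC ec)))

      closed-up-to-sign : (W : Walk (EC p b) c d) → hops W ≢ [] → VC p b c → VC p b d →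
                          proj₁ d ≡ proj₁ c → ⊥
      closed-up-to-sign {c} {d} W ne vc vd same with same-node {x = d} {y = c} same
      ... | inj₁ refl = acyclic⇒¬cycle ac W ne
      ... | inj₂ refl = sc _ vc vd

      -- The first arc puts the start or its flip into C; from there the walk, or its
      -- reverse, runs inside C and closes up.
      no-EC±-cycloid : (W : Walk EC± c d) → hops W ≢ [] → proj₁ d ≡ proj₁ c → ⊥
      no-EC±-cycloid (walk [] _ _ _) ne _ = ne refl
      no-EC±-cycloid W@(walk (_ ∷ _) _ _ (inj₁ ec ∷ _)) ne same =
        closed-up-to-sign W′ ne vc (propagate-end (proj₂ ∘ EC⇒VC) vc W′) same
        where
          vc = proj₁ (EC⇒VC ec)
          W′ = relabel W (EC±-from-C vc W)
      no-EC±-cycloid W@(walk (_ ∷ _) _ _ (inj₂ ec ∷ _)) ne same =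
        closed-up-to-sign (relabel R ecs) (reverse-nonempty EC±-mirror W ne) vd̂ vĉ (sym same)
        where
          R = reverseʷ EC±-mirror W
          vĉ = proj₂ (EC⇒VC ec)
          vd̂ = proj₁ (EC±-into-C vĉ R)
          ecs = proj₂ (EC±-into-C vĉ R)

      bubble-acyclic : BAcyclic G p q
      bubble-acyclic (x , xs , (st , ne , same) , ebs) =
        no-EC±-cycloid (walk xs (bSteps⇒dSteps x xs st) refl
                   (All.map EB⇒EC± (All.map⁻ (subst (All (InEB G p q)) (bEdges≡ x xs) ebs))))
                ne (trans (cong proj₁ (sym (bLast≡dLast x xs))) same)

  bidirected⇒directed : (a c : N) → proj₁ a ≢ proj₁ c → BSeparable G a c → BAcyclic G a c →
                        SignConsistent a (flipS c) × Sep a (flipS c) × Acy a (flipS c)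
  bidirected⇒directed a c a≁c bsep bacy = sc , directed-separable sc , directed-acyclic sc
    where
      open Bubble.FromBubble a c bsep bacy
      sc = consistent a≁c

  -- The two equations spare the callers transports along flipS-involutive.
  directed⇒bidirected : {a′ d : N} (a c : N) → a′ ≡ a → d ≡ flipS c →
                        SignConsistent a′ d → Sep a′ d → Acy a′ d → BSeparable G a c × BAcyclic G a c
  directed⇒bidirected a c refl refl sc sp ac = bubble-separable , bubble-acyclic
    where open Bubble.FromSuperbubble a c sc sp ac

  -- The walk lies in B(a,w); followed by the reverse of a bidirected path a ⇝ ŵ of B it
  -- becomes a cycloid a ⇝ â.
  avoiding-walk⇒¬bubble : (W : Walk P a w) → w ≢ a → flipS w ∉ nodes W →
                    BSeparable G a w → BAcyclic G a w → ⊥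
  avoiding-walk⇒¬bubble {a = a} {w} W w≢a ŵ∉ bsep bacy =
    bidirected-trace W (λ k s≡ŵ → ŵ∉ (subst (_∈ nodes W) s≡ŵ (source∈nodes W k))) λ ebs →
      let _ , m = distinct⇒arc (w≢a ∘ sym) W
          _ , bp , _ = All.lookup ebs m
      in complementary-walks (relabel W ebs) (bpath-walk bp)
    where
      open Bubble a w
      open FromBubble bsep bacy

  module _ (p q : N) (p≁q : proj₁ p ≢ proj₁ q) where

    open Bubble p q using (b; VB⇒VC; module Consistent)

    ultrabubble⇒minimal : SignConsistent p b → Sep p b → BMinimal G p q → DMinimal A p b
    ultrabubble⇒minimal sc sp bmin (z , vz , z≢p , z≢b , sep₁ , acy₁ , sep₂ , acy₂) =
      bmin (flipS z , VC⇒VB vz , z≁ p z≢p (inj₁ refl) , z≁ b z≢b (inj₂ (inj₁ refl)) ,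
            proj₁ bubble₁ , proj₂ bubble₁ , proj₁ bubble₂ , proj₂ bubble₂)
      where
        open Consistent sc
        sc₁ = consistent-⊑ sc (prefix-subcomponent sp vz)
        sc₂ = consistent-⊑ sc (suffix-subcomponent sp vz)
        bubble₁ = directed⇒bidirected p (flipS z) refl (sym (flipS-involutive z)) sc₁ sep₁ acy₁
        bubble₂ = directed⇒bidirected (flipS (flipS z)) q (sym (flipS-involutive z)) refl sc₂ sep₂ acy₂
        z≁ : ∀ y → z ≢ y → VC p b y → proj₁ z ≢ proj₁ y
        z≁ y z≢y vy same with same-node {x = z} {y = y} same
        ... | inj₁ z≡y = z≢y z≡y
        ... | inj₂ refl = sc y vy vz

    superbubble⇒minimal : SignConsistent p b → DMinimal A p b → BMinimal G p q
    superbubble⇒minimal sc dmin (w , vb , w≁p , w≁q , bsep₁ , bacy₁ , bsep₂ , bacy₂)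
      with VB⇒VC {w = w} vb
    ... | x , vx , same with same-node {x = x} {y = w} same
    ...   | inj₂ refl =
      dmin (flipS w , vx , w≁p ∘ cong proj₁ , w≁q ∘ cong proj₁ ,
            proj₁ (proj₂ directed₁) , proj₂ (proj₂ directed₁) ,
            proj₁ (proj₂ directed₂) , proj₂ (proj₂ directed₂))
      where
        directed₁ = bidirected⇒directed p w (w≁p ∘ sym) bsep₁ bacy₁
        directed₂ = bidirected⇒directed (flipS w) q w≁q bsep₂ bacy₂
    ...   | inj₁ refl = inner vx
      where
        inner : VC p b w → ⊥
        inner (inj₁ w≡p) = w≁p (cong proj₁ w≡p)
        inner (inj₂ (inj₁ w≡b)) = w≁q (cong proj₁ w≡b)
        inner (inj₂ (inj₂ (_ , π , m))) =
          avoiding-walk⇒¬bubble (prefix (path-walk π) m) (w≁p ∘ cong proj₁) ŵ∉ bsep₁ bacy₁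
          where
            ŵ∉ : flipS w ∉ nodes (prefix (path-walk π) m)
            ŵ∉ k = sc w (on-path π m) (on-path π (prefix-nodes⊆ (path-walk π) m k))

    ultrabubble⇒superbubble : IsUltrabubble G p q → IsWeakSuperbubble A p b
    ultrabubble⇒superbubble (_ , bsep , bacy , bmin) =
      let sc , sp , ac = bidirected⇒directed p q p≁q bsep bacy
      in p≁q ∘ cong proj₁ , sp , ac , ultrabubble⇒minimal sc sp bmin

    superbubble⇒ultrabubble : IsWeakSuperbubble A p b → IsUltrabubble G p q
    superbubble⇒ultrabubble wsb@(_ , sp , ac , dmin) =
      let sc = superbubble⇒consistent wsb (p≁q ∘ cong proj₁)
          bsep , bacy = directed⇒bidirected p q refl refl sc sp ac
      in p≁q , bsep , bacy , superbubble⇒minimal sc dmin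

theorem14 : (G : Bidirected) (u v : Fin (Bidirected.n G)) (α β : Sign) →
    IsUltrabubble G (u , α) (v , β) ⇔
      (u ≢ v
      × IsWeakSuperbubble (doubledArcs G) (u , α) (v , hat β)
      × IsWeakSuperbubble (doubledArcs G) (v , β) (u , hat α))
theorem14 G u v α β = mk⇔
  (λ ub → let wsb = ultrabubble⇒superbubble p q (proj₁ ub) ub in proj₁ ub , wsb , mirrored wsb)
  (λ (u≢v , wsb , _) → superbubble⇒ultrabubble p q u≢v wsb)
  where
    open Correspondence G
    open Doubled G using (N; A; superbubble-flip)

    p q : N
    p = u , α
    q = v , β

    mirrored : IsWeakSuperbubble A p (flipS q) → IsWeakSuperbubble A q (flipS p)
    mirrored wsb = subst (λ β′ → IsWeakSuperbubble A (v , β′) (flipS p)) (hat-involutive β)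
                         (superbubble-flip wsb)
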